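{- Let $\psi$ be any finite word over $\{\mathtt q,\mathtt s\}$, let $\pi=\Pi(\psi)$, let $W\in\{a,d\}^*$ and let $k_1,k_2$ be states of $\pi$. If $f_\pi(k_1,W)\ge k_2$, then $f_\pi(k,W)\ge k_2$ for every state $k\ge k_1$.
   Context: For $\psi\in\{\mathtt q,\mathtt s\}^N$ indexed $\psi(0),\dots,\psi(N-1)$, the chain automaton $\Pi(\psi)$ is the DFA over $\{a,d\}$ with states $\{0,\dots,N\}$, start state $0$, accepting states $\{0,\dots,N-1\}$, transition from state $k<N$ on letter $c$ to $k+[\psi(k)=\mathtt q\text{ and }c=d]+[\psi(k)=\mathtt s\text{ and }c=a]$ (Iverson brackets), with state $N$ absorbing. $f_\pi(k,W)$ denotes the state reached by $\pi$ started in state $k$ after reading the word $W$. -}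

module Defs where

open import Data.Nat using (ℕ; zero; suc)
open import Data.List using (List; []; _∷_)

data QS : Set where
  q s : QS

data Letter : Set where
  a d : Letter

-- Increment of the chain automaton in a non-absorbing state with label x on letter c:
-- [x = q and c = d] + [x = s and c = a].
bump : QS → Letter → ℕ
bump q a = 0
bump q d = 1
bump s a = 1
bump s d = 0

-- One transition of Π(ψ) from state k (states are 0..N with N = length ψ).
-- State k < N moves to k + bump (ψ k) c; state N (i.e. the list is exhausted) is absorbing.
step : List QS → ℕ → Letter → ℕ
step []      k       c = k
step (x ∷ ψ) zero    c = bump x c
step (x ∷ ψ) (suc k) c = suc (step ψ k c)

run : List QS → ℕ → List Letter → ℕ
run ψ k []      = k
run ψ k (c ∷ W) = run ψ (step ψ k c) W

{-# OPTIONS --safe #-}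
module Submission where

open import Defs
open import Data.Nat using (ℕ; _≤_; zero; suc; z≤n; s≤s)
open import Data.Nat.Properties using (≤-refl; ≤-trans)
open import Data.List using (List; length; []; _∷_)

-- A chain automaton never lets a lower state overtake a higher one: each
-- transition moves a state up by at most one, so every transition map, and
-- hence every run map k ↦ f_π(k, W), is monotone.

bump≤1 : ∀ x c → bump x c ≤ 1
bump≤1 q a = z≤n
bump≤1 q d = s≤s z≤n
bump≤1 s a = s≤s z≤n
bump≤1 s d = z≤n

step-mono-≤ : ∀ ψ c {k k′} → k ≤ k′ → step ψ k c ≤ step ψ k′ c
step-mono-≤ []      c k≤k′                       = k≤k′
step-mono-≤ (x ∷ ψ) c {zero}  {zero}   _         = ≤-refl
step-mono-≤ (x ∷ ψ) c {zero}  {suc k′} _         = ≤-trans (bump≤1 x c) (s≤s z≤n)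
step-mono-≤ (x ∷ ψ) c {suc k} {suc k′} (s≤s k≤k′) = s≤s (step-mono-≤ ψ c k≤k′)

run-mono-≤ : ∀ ψ W {k k′} → k ≤ k′ → run ψ k W ≤ run ψ k′ W
run-mono-≤ ψ []      k≤k′ = k≤k′
run-mono-≤ ψ (c ∷ W) k≤k′ = run-mono-≤ ψ W (step-mono-≤ ψ c k≤k′)

lemma6 : (ψ : List QS) (W : List Letter) (k₁ k₂ : ℕ) →
         k₁ ≤ length ψ → k₂ ≤ length ψ →
         k₂ ≤ run ψ k₁ W →
         (k : ℕ) → k ≤ length ψ → k₁ ≤ k → k₂ ≤ run ψ k W
lemma6 ψ W k₁ k₂ _ _ k₂≤run k _ k₁≤k = ≤-trans k₂≤run (run-mono-≤ ψ W k₁≤k)
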